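{- Let $t\ge1$, $2\le k_1\le k_2\le\cdots\le k_t$ be integers and $\kappa:=\sum_{i=1}^t(k_i-1)$. If $k_t=2$, then $K_{t,2t+1}^{p}$ contains $C_{4,4,\ldots,4}$ (the graph of $t$ four-cycles intersecting in exactly one common vertex) as a subgraph. If $k_t\ge3$, then both $K_{\kappa,\kappa+t+1}^{p}$ and $K_{\kappa,\kappa+t+1}^{m}$ contain $C_{2k_1,2k_2,\ldots,2k_t}$ as a subgraph.
   Context: $C_{2k_1,\ldots,2k_t}$ is the graph obtained from cycles $C_{2k_1},\ldots,C_{2k_t}$ intersecting in exactly one common vertex. For $a\ge1$, $b\ge4$ (resp. $b\ge 3$), $K_{a,b}^{p}:=aK_1\vee((b-3)K_1\cup P_3)$ is obtained from the complete bipartite graph $K_{a,b}$ by adding a path on $3$ vertices inside the part of size $b$, and $K_{a,b}^{m}:=aK_1\vee((b-4)K_1\cup 2K_2)$ is obtained from $K_{a,b}$ by adding a matching with two edges inside the part of size $b$. -}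

module Defs where

open import Data.Nat using (ℕ; zero; suc; _+_; _*_; _∸_; _≤_)
open import Data.Nat.ListAction using (sum)
open import Data.Fin using (Fin; toℕ; fromℕ)
import Data.Fin as F
open import Data.List using (map; allFin)
open import Data.Product using (Σ; _×_; ∃)
open import Data.Sum using (_⊎_; inj₁; inj₂)
open import Data.Unit using (⊤; tt)
open import Data.Empty using (⊥)
open import Relation.Binary.PropositionalEquality using (_≡_)
open import Function.Definitions using (Injective)

record Graph : Set₁ where
  field
    V   : Set
    Adj : V → V → Set
open Graph public

_⊆G_ : Graph → Graph → Set
H ⊆G G = Σ (V H → V G) λ f → Injective _≡_ _≡_ f × (∀ u v → Adj H u v → Adj G (f u) (f v))

-- Extra edges inside the part of size b (on indices 0,1,2,3 of that part).
-- P3 on vertices 0-1-2: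
data P3Edge : ℕ → ℕ → Set where
  e01 : P3Edge 0 1
  e10 : P3Edge 1 0
  e12 : P3Edge 1 2
  e21 : P3Edge 2 1

data M2Edge : ℕ → ℕ → Set where
  e01 : M2Edge 0 1
  e10 : M2Edge 1 0
  e23 : M2Edge 2 3
  e32 : M2Edge 3 2

KabPlus : (ℕ → ℕ → Set) → ℕ → ℕ → Graph
KabPlus E a b = record { V = Fin a ⊎ Fin b ; Adj = adj }
  where
  adj : Fin a ⊎ Fin b → Fin a ⊎ Fin b → Set
  adj (inj₁ _) (inj₁ _) = ⊥
  adj (inj₁ _) (inj₂ _) = ⊤
  adj (inj₂ _) (inj₁ _) = ⊤
  adj (inj₂ x) (inj₂ y) = E (toℕ x) (toℕ y)

-- K^p_{a,b} = aK1 ∨ ((b-3)K1 ∪ P3)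
Kp : ℕ → ℕ → Graph
Kp = KabPlus P3Edge

-- K^m_{a,b} = aK1 ∨ ((b-4)K1 ∪ 2K2)
Km : ℕ → ℕ → Graph
Km = KabPlus M2Edge

-- C_{2k_1,...,2k_t}: a hub plus, for each i, a path of 2k_i - 1 vertices
-- (indexed 0..2k_i-2) whose two ends are joined to the hub.
FlowerAdj : (t : ℕ) (k : Fin t → ℕ) →
  (⊤ ⊎ Σ (Fin t) (λ i → Fin (2 * k i ∸ 1))) →
  (⊤ ⊎ Σ (Fin t) (λ i → Fin (2 * k i ∸ 1))) → Set
FlowerAdj t k (inj₁ _) (inj₁ _) = ⊥
FlowerAdj t k (inj₁ _) (inj₂ (i Data.Product., j)) =
  toℕ j ≡ 0 ⊎ suc (toℕ j) ≡ 2 * k i ∸ 1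
FlowerAdj t k (inj₂ (i Data.Product., j)) (inj₁ _) =
  toℕ j ≡ 0 ⊎ suc (toℕ j) ≡ 2 * k i ∸ 1
FlowerAdj t k (inj₂ (i Data.Product., j)) (inj₂ (i' Data.Product., j')) =
  i ≡ i' × (suc (toℕ j) ≡ toℕ j' ⊎ suc (toℕ j') ≡ toℕ j)

Flower : (t : ℕ) → (Fin t → ℕ) → Graph
Flower t k = record
  { V = ⊤ ⊎ Σ (Fin t) (λ i → Fin (2 * k i ∸ 1))
  ; Adj = FlowerAdj t k }

kappa : (t : ℕ) → (Fin t → ℕ) → ℕ
kappa t k = sum (map (λ i → k i ∸ 1) (allFin t))

{-# OPTIONS --safe #-}
-- The flower is bipartite: the hub and the odd positions of the petals form a side of
-- size κ + 1, the even positions a side of size κ + t, so K_{κ,κ+t+1} misses only by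
-- one vertex on the small side. The edges added inside the large side pay for this:
-- in the last (longest) petal, position 1 moves to the large side, its two path edges
-- supplied by the P₃ on positions 0, 1, 2; with a matching instead, positions 1 and 3
-- move and position 2 takes the other side, so that the path 0 1 2 3 4 uses the
-- matching edges {0,1} and {3,4}; the hub takes the freed slot on the small side.
-- The matching needs k_t ≥ 3; when k_t = 2 all k_i = 2, so κ = t.
module Submission where

open import Defs
open import Data.Nat using (ℕ; suc; _+_; _*_; _≤_)
open import Data.Fin using (Fin; fromℕ)
import Data.Fin
open import Data.Product using (_×_)
open import Relation.Binary.PropositionalEquality using (_≡_)

open import Data.Nat using (zero; _∸_; _<_; s≤s; z<s; s<s; s≤s⁻¹; s<s⁻¹)
open import Data.Nat.Properties
  using ( +-0-commutativeMonoid; +-comm; +-identityʳ; *-suc; *-cancelˡ-≤; *-cancelˡ-<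
        ; suc-injective; <⇒≤; ∸-monoˡ-≤; ≤-antisym)
open import Data.Nat.Tactic.RingSolver using (solve-∀)
import Data.Nat.ListAction as List
open import Algebra.Properties.CommutativeMonoid.Sum +-0-commutativeMonoid
  using (sum; ∑-distrib-+; sum-init-last; sum-cong-≗)
open import Data.Fin using (zero; suc; toℕ; fromℕ<; inject₁; _↑ˡ_; _↑ʳ_; splitAt)
open import Data.Fin.Properties
  using (toℕ-fromℕ<; toℕ-↑ˡ; toℕ-injective; splitAt-↑ˡ; splitAt-↑ʳ; toℕ<n; ≤fromℕ)
open import Data.Fin.Relation.Unary.Top using (view; ‵fromℕ; ‵inject₁)
open import Data.List using (tabulate)
open import Data.List.Properties using (map-tabulate)
open import Data.Product using (Σ; _,_; map; map₁)
open import Data.Product.Properties using (,-injective)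
open import Data.Sum using (_⊎_; inj₁; inj₂; [_,_]′; map₂)
open import Data.Sum.Properties using (inj₂-injective)
open import Data.Unit using (⊤; tt)
open import Data.Empty using (⊥)
open import Function using (_∘_; id)
open import Function.Definitions using (Injective)
open import Relation.Binary.Definitions using (Symmetric)
open import Relation.Binary.PropositionalEquality
  using (refl; sym; trans; cong; subst; subst₂; module ≡-Reasoning)

sum-ones : ∀ n → sum {n} (λ _ → 1) ≡ n
sum-ones zero = refl
sum-ones (suc n) = cong suc (sum-ones n)

sum-suc : ∀ {n} (g : Fin n → ℕ) → sum (suc ∘ g) ≡ n + sum g
sum-suc {n} g = trans (∑-distrib-+ (λ _ → 1) g) (cong (_+ sum g) (sum-ones n))

sum-tabulate : ∀ {n} (g : Fin n → ℕ) → List.sum (tabulate g) ≡ sum g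
sum-tabulate {zero} g = refl
sum-tabulate {suc n} g = cong (g zero +_) (sum-tabulate (g ∘ suc))

kappa≡sum : ∀ t (k : Fin t → ℕ) → kappa t k ≡ sum (λ i → k i ∸ 1)
kappa≡sum t k =
  trans (cong List.sum (map-tabulate id (λ i → k i ∸ 1))) (sum-tabulate {t} (λ i → k i ∸ 1))

joinΣ : ∀ {n} (g : Fin n → ℕ) → Σ (Fin n) (Fin ∘ g) → Fin (sum g)
joinΣ g (zero , r) = r ↑ˡ _
joinΣ g (suc i , r) = g zero ↑ʳ joinΣ (g ∘ suc) (i , r)

splitΣ : ∀ {n} (g : Fin n → ℕ) → Fin (sum g) → Σ (Fin n) (Fin ∘ g)
splitΣ {suc n} g x = [ zero ,_ , map suc id ∘ splitΣ (g ∘ suc) ]′ (splitAt (g zero) x)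

splitΣ-joinΣ : ∀ {n} (g : Fin n → ℕ) x → splitΣ g (joinΣ g x) ≡ x
splitΣ-joinΣ g (zero , r) rewrite splitAt-↑ˡ (g zero) r (sum (g ∘ suc)) = refl
splitΣ-joinΣ g (suc i , r)
  rewrite splitAt-↑ʳ (g zero) (sum (g ∘ suc)) (joinΣ (g ∘ suc) (i , r))
        | splitΣ-joinΣ (g ∘ suc) (i , r) = refl

data Halved : Set where
  even odd : ℕ → Halved

unhalve : Halved → ℕ
unhalve (even h) = 2 * h
unhalve (odd h) = suc (2 * h)

next : Halved → Halved
next (even h) = odd h
next (odd h) = even (suc h)

halve : ℕ → Halved
halve zero = even 0
halve (suc n) = next (halve n)

unhalve-next : ∀ x → unhalve (next x) ≡ suc (unhalve x)
unhalve-next (even h) = refl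
unhalve-next (odd h) = *-suc 2 h

unhalve-halve : ∀ n → unhalve (halve n) ≡ n
unhalve-halve zero = refl
unhalve-halve (suc n) = trans (unhalve-next (halve n)) (cong suc (unhalve-halve n))

halve-injective : ∀ {m n} → halve m ≡ halve n → m ≡ n
halve-injective {m} {n} e = trans (sym (unhalve-halve m)) (trans (cong unhalve e) (unhalve-halve n))

halve-double : ∀ h → halve (2 * h) ≡ even h
halve-double zero = refl
halve-double (suc h) = trans (cong halve (*-suc 2 h)) (cong (next ∘ next) (halve-double h))

Fits : ℕ → Halved → Set
Fits M (even h) = h < suc M
Fits M (odd h) = h < M

unhalve<⇒Fits : ∀ {M} x → unhalve x < suc (2 * M) → Fits M x
unhalve<⇒Fits (even h) p = s≤s (*-cancelˡ-≤ 2 (s≤s⁻¹ p))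
unhalve<⇒Fits {M} (odd h) p = *-cancelˡ-< 2 h M (s<s⁻¹ p)

halve-Fits : ∀ {M n} → n < suc (2 * M) → Fits M (halve n)
halve-Fits {n = n} p = unhalve<⇒Fits (halve n) (subst (_< _) (sym (unhalve-halve n)) p)

-- A vertex of `KabPlus E a b` given by its index in the part of size a (inj₁) or b (inj₂).
Slot : Set
Slot = ℕ ⊎ ℕ

InRange : ℕ → ℕ → Slot → Set
InRange a b (inj₁ x) = x < a
InRange a b (inj₂ y) = y < b

SlotAdj : (ℕ → ℕ → Set) → Slot → Slot → Set
SlotAdj E (inj₁ _) (inj₁ _) = ⊥
SlotAdj E (inj₁ _) (inj₂ _) = ⊤
SlotAdj E (inj₂ _) (inj₁ _) = ⊤
SlotAdj E (inj₂ y) (inj₂ y′) = E y y′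

InB : {A B : Set} → A ⊎ B → Set
InB (inj₁ _) = ⊥
InB (inj₂ _) = ⊤

KabPlus-sym : ∀ {E} → Symmetric E → ∀ {a b} u v →
              Adj (KabPlus E a b) u v → Adj (KabPlus E a b) v u
KabPlus-sym E-sym (inj₁ _) (inj₂ _) _ = tt
KabPlus-sym E-sym (inj₂ _) (inj₁ _) _ = tt
KabPlus-sym E-sym (inj₂ _) (inj₂ _) e = E-sym e

KabPlus-adj-inB : ∀ {E a b} x w → InB w → Adj (KabPlus E a b) (inj₁ x) w
KabPlus-adj-inB x (inj₂ _) _ = tt

P3Edge-sym : Symmetric P3Edge
P3Edge-sym e01 = e10
P3Edge-sym e10 = e01
P3Edge-sym e12 = e21
P3Edge-sym e21 = e12

M2Edge-sym : Symmetric M2Edge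
M2Edge-sym e01 = e10
M2Edge-sym e10 = e01
M2Edge-sym e23 = e32
M2Edge-sym e32 = e23

-- An embedding of the cycle C_{2M+2}, viewed as a hub together with a path on the
-- positions 0 … 2M whose ends are joined to the hub, into KabPlus E M (M + 2).
record CycleLayout (E : ℕ → ℕ → Set) (M : ℕ) : Set where
  field
    place         : Halved → Slot
    unplace       : Slot → ⊤ ⊎ Halved
    0<M           : 0 < M
    unplace-hub   : unplace (inj₁ 0) ≡ inj₁ tt
    place-inRange : ∀ x → Fits M x → InRange M (suc (suc M)) (place x)
    unplace-place : ∀ x → unplace (place x) ≡ inj₂ x
    place-next    : ∀ x → SlotAdj E (place x) (place (next x))
    place-first   : InB (place (even 0))
    place-last    : InB (place (even M))

p3Layout : ∀ {M} → 1 ≤ M → CycleLayout P3Edge M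
p3Layout {zero} ()
p3Layout {suc M} _ = record
  { place = place
  ; unplace = unplace
  ; 0<M = z<s
  ; unplace-hub = refl
  ; place-inRange = place-inRange
  ; unplace-place = unplace-place
  ; place-next = place-next
  ; place-first = tt
  ; place-last = tt
  }
  where
  place : Halved → Slot
  place (even zero) = inj₂ 0
  place (even (suc h)) = inj₂ (suc (suc h))
  place (odd zero) = inj₂ 1
  place (odd (suc h)) = inj₁ (suc h)

  unplace : Slot → ⊤ ⊎ Halved
  unplace (inj₁ zero) = inj₁ tt
  unplace (inj₁ (suc h)) = inj₂ (odd (suc h))
  unplace (inj₂ zero) = inj₂ (even 0)
  unplace (inj₂ (suc zero)) = inj₂ (odd 0)
  unplace (inj₂ (suc (suc h))) = inj₂ (even (suc h))

  place-inRange : ∀ x → Fits (suc M) x → InRange (suc M) (suc (suc (suc M))) (place x)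
  place-inRange (even zero) _ = z<s
  place-inRange (even (suc h)) p = s<s p
  place-inRange (odd zero) _ = s<s z<s
  place-inRange (odd (suc h)) p = p

  unplace-place : ∀ x → unplace (place x) ≡ inj₂ x
  unplace-place (even zero) = refl
  unplace-place (even (suc h)) = refl
  unplace-place (odd zero) = refl
  unplace-place (odd (suc h)) = refl

  place-next : ∀ x → SlotAdj P3Edge (place x) (place (next x))
  place-next (even zero) = e01
  place-next (even (suc h)) = tt
  place-next (odd zero) = e12
  place-next (odd (suc h)) = tt

m2Layout : ∀ {M} → 2 ≤ M → CycleLayout M2Edge M
m2Layout {suc zero} (s≤s ())
m2Layout {suc (suc M)} _ = record
  { place = place
  ; unplace = unplace
  ; 0<M = z<s
  ; unplace-hub = refl
  ; place-inRange = place-inRange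
  ; unplace-place = unplace-place
  ; place-next = place-next
  ; place-first = tt
  ; place-last = tt
  }
  where
  place : Halved → Slot
  place (even zero) = inj₂ 0
  place (even (suc zero)) = inj₁ 1
  place (even (suc (suc h))) = inj₂ (3 + h)
  place (odd zero) = inj₂ 1
  place (odd (suc zero)) = inj₂ 2
  place (odd (suc (suc h))) = inj₁ (2 + h)

  unplace : Slot → ⊤ ⊎ Halved
  unplace (inj₁ zero) = inj₁ tt
  unplace (inj₁ (suc zero)) = inj₂ (even 1)
  unplace (inj₁ (suc (suc h))) = inj₂ (odd (2 + h))
  unplace (inj₂ zero) = inj₂ (even 0)
  unplace (inj₂ (suc zero)) = inj₂ (odd 0)
  unplace (inj₂ (suc (suc zero))) = inj₂ (odd 1)
  unplace (inj₂ (suc (suc (suc h)))) = inj₂ (even (2 + h))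

  place-inRange : ∀ x → Fits (2 + M) x → InRange (2 + M) (4 + M) (place x)
  place-inRange (even zero) _ = z<s
  place-inRange (even (suc zero)) _ = s<s z<s
  place-inRange (even (suc (suc h))) p = s<s p
  place-inRange (odd zero) _ = s<s z<s
  place-inRange (odd (suc zero)) _ = s<s (s<s z<s)
  place-inRange (odd (suc (suc h))) p = p

  unplace-place : ∀ x → unplace (place x) ≡ inj₂ x
  unplace-place (even zero) = refl
  unplace-place (even (suc zero)) = refl
  unplace-place (even (suc (suc h))) = refl
  unplace-place (odd zero) = refl
  unplace-place (odd (suc zero)) = refl
  unplace-place (odd (suc (suc h))) = refl

  place-next : ∀ x → SlotAdj M2Edge (place x) (place (next x))
  place-next (even zero) = e01
  place-next (even (suc zero)) = tt
  place-next (even (suc (suc h))) = tt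
  place-next (odd zero) = tt
  place-next (odd (suc zero)) = e23
  place-next (odd (suc (suc h))) = tt

2*n∸1≡suc[2*[n∸1]] : ∀ {n} → 1 ≤ n → 2 * n ∸ 1 ≡ suc (2 * (n ∸ 1))
2*n∸1≡suc[2*[n∸1]] {suc n} _ = cong (_∸ 1) (*-suc 2 n)

-- The hub and the last petal fill a front block of sizes M, M + 2 by the cycle layout;
-- behind it every other petal j fills blocks of sizes N j, N j + 1 of its own.
-- A target vertex is decoded back to (petal, position) by splitting these blocks.
module FlowerEmbedding {E : ℕ → ℕ → Set} (E-sym : Symmetric E)
  (s : ℕ) (k : Fin (suc s) → ℕ) (k≥1 : ∀ i → 1 ≤ k i)
  (layout : CycleLayout E (k (fromℕ s) ∸ 1)) where

  open CycleLayout layout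

  m : Fin (suc s) → ℕ
  m i = k i ∸ 1

  M : ℕ
  M = m (fromℕ s)

  N : Fin s → ℕ
  N j = m (inject₁ j)

  N⁺ : Fin s → ℕ
  N⁺ j = suc (N j)

  G : Graph
  G = KabPlus E (M + sum N) (suc (suc M) + sum N⁺)

  position-Fits : ∀ i (j : Fin (2 * k i ∸ 1)) → Fits (m i) (halve (toℕ j))
  position-Fits i j = halve-Fits (subst (toℕ j <_) (2*n∸1≡suc[2*[n∸1]] (k≥1 i)) (toℕ<n j))

  end-position : ∀ i (j : Fin (2 * k i ∸ 1)) → toℕ j ≡ 0 ⊎ suc (toℕ j) ≡ 2 * k i ∸ 1 →
                 halve (toℕ j) ≡ even 0 ⊎ halve (toℕ j) ≡ even (m i)
  end-position i j (inj₁ e) = inj₁ (cong halve e)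
  end-position i j (inj₂ e) = inj₂ (trans (cong halve toℕj≡2m) (halve-double (m i)))
    where
    toℕj≡2m : toℕ j ≡ 2 * m i
    toℕj≡2m = suc-injective (trans e (2*n∸1≡suc[2*[n∸1]] (k≥1 i)))

  front : (σ : Slot) → .(InRange M (suc (suc M)) σ) → V G
  front (inj₁ x) p = inj₁ (fromℕ< p ↑ˡ sum N)
  front (inj₂ y) p = inj₂ (fromℕ< p ↑ˡ sum N⁺)

  ordinary : (j : Fin s) (x : Halved) → .(Fits (N j) x) → V G
  ordinary j (even h) p = inj₂ (suc (suc M) ↑ʳ joinΣ N⁺ (j , fromℕ< p))
  ordinary j (odd h) p = inj₁ (M ↑ʳ joinΣ N (j , fromℕ< p))

  petalVertex : (i : Fin (suc s)) (x : Halved) → .(Fits (m i) x) → V G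
  petalVertex i x p with view i
  ... | ‵fromℕ = front (place x) (place-inRange x p)
  ... | ‵inject₁ j = ordinary j x p

  embed : V (Flower (suc s) k) → V G
  embed (inj₁ _) = front (inj₁ 0) 0<M
  embed (inj₂ (i , j)) = petalVertex i (halve (toℕ j)) (position-Fits i j)

  code : V (Flower (suc s) k) → ⊤ ⊎ (Fin (suc s) × Halved)
  code (inj₁ _) = inj₁ tt
  code (inj₂ (i , j)) = inj₂ (i , halve (toℕ j))

  code-injective : Injective _≡_ _≡_ code
  code-injective {inj₁ tt} {inj₁ tt} _ = refl
  code-injective {inj₂ (i , j)} {inj₂ (i′ , j′)} e with ,-injective (inj₂-injective e)
  ... | refl , e′ = cong (λ j → inj₂ (i , j)) (toℕ-injective (halve-injective e′))

  atOrdinary : ∀ {g : Fin s → ℕ} → (ℕ → Halved) → Σ (Fin s) (Fin ∘ g) → Fin s × Halved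
  atOrdinary c (j , r) = j , c (toℕ r)

  locate : V G → Slot ⊎ (Fin s × Halved)
  locate (inj₁ x) = [ inj₁ ∘ inj₁ ∘ toℕ , inj₂ ∘ atOrdinary odd ∘ splitΣ N ]′ (splitAt M x)
  locate (inj₂ y) =
    [ inj₁ ∘ inj₂ ∘ toℕ , inj₂ ∘ atOrdinary even ∘ splitΣ N⁺ ]′ (splitAt (suc (suc M)) y)

  locate-front : ∀ σ .p → locate (front σ p) ≡ inj₁ σ
  locate-front (inj₁ x) p rewrite splitAt-↑ˡ M (fromℕ< p) (sum N) | toℕ-fromℕ< p = refl
  locate-front (inj₂ y) p
    rewrite splitAt-↑ˡ (suc (suc M)) (fromℕ< p) (sum N⁺) | toℕ-fromℕ< p = refl

  locate-ordinary : ∀ j x .p → locate (ordinary j x p) ≡ inj₂ (j , x)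
  locate-ordinary j (even h) p
    rewrite splitAt-↑ʳ (suc (suc M)) (sum N⁺) (joinΣ N⁺ (j , fromℕ< p))
          | splitΣ-joinΣ N⁺ (j , fromℕ< p) | toℕ-fromℕ< p = refl
  locate-ordinary j (odd h) p
    rewrite splitAt-↑ʳ M (sum N) (joinΣ N (j , fromℕ< p))
          | splitΣ-joinΣ N (j , fromℕ< p) | toℕ-fromℕ< p = refl

  decode : V G → ⊤ ⊎ (Fin (suc s) × Halved)
  decode w = [ map₂ (fromℕ s ,_) ∘ unplace , inj₂ ∘ map₁ inject₁ ]′ (locate w)

  decode-petalVertex : ∀ i x .p → decode (petalVertex i x p) ≡ inj₂ (i , x)
  decode-petalVertex i x p with view i
  ... | ‵fromℕ rewrite locate-front (place x) (place-inRange x p) | unplace-place x = refl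
  ... | ‵inject₁ j rewrite locate-ordinary j x p = refl

  decode-embed : ∀ v → decode (embed v) ≡ code v
  decode-embed (inj₁ _) rewrite locate-front (inj₁ 0) 0<M | unplace-hub = refl
  decode-embed (inj₂ (i , j)) = decode-petalVertex i (halve (toℕ j)) (position-Fits i j)

  embed-injective : Injective _≡_ _≡_ embed
  embed-injective {u} {v} e = code-injective (begin
    code u           ≡⟨ sym (decode-embed u) ⟩
    decode (embed u) ≡⟨ cong decode e ⟩
    decode (embed v) ≡⟨ decode-embed v ⟩
    code v           ∎)
    where open ≡-Reasoning

  G-sym : ∀ u v → Adj G u v → Adj G v u
  G-sym = KabPlus-sym E-sym

  front-adj : ∀ σ τ .p .q → SlotAdj E σ τ → Adj G (front σ p) (front τ q)
  front-adj (inj₁ _) (inj₂ _) p q _ = tt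
  front-adj (inj₂ _) (inj₁ _) p q _ = tt
  front-adj (inj₂ y) (inj₂ y′) p q e = subst₂ E (sym (toℕ-front p)) (sym (toℕ-front q)) e
    where
    toℕ-front : ∀ {z} .(r : z < suc (suc M)) → toℕ (fromℕ< r ↑ˡ sum N⁺) ≡ z
    toℕ-front r = trans (toℕ-↑ˡ (fromℕ< r) _) (toℕ-fromℕ< r)

  front-inB : ∀ σ .p → InB σ → InB (front σ p)
  front-inB (inj₂ _) _ _ = tt

  petalVertex-next : ∀ i x y .p .q → next x ≡ y → Adj G (petalVertex i x p) (petalVertex i y q)
  petalVertex-next i x .(next x) p q refl with view i
  ... | ‵fromℕ = front-adj (place x) (place (next x)) _ _ (place-next x)
  ... | ‵inject₁ j = ordinary-next x
    where
    ordinary-next : ∀ x .{p q} → Adj G (ordinary j x p) (ordinary j (next x) q)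
    ordinary-next (even h) = tt
    ordinary-next (odd h) = tt

  petalVertex-inB : ∀ i x .p → x ≡ even 0 ⊎ x ≡ even (m i) → InB (petalVertex i x p)
  petalVertex-inB i x p end with view i
  ... | ‵fromℕ = front-inB (place x) _ (place-end end)
    where
    place-end : x ≡ even 0 ⊎ x ≡ even M → InB (place x)
    place-end (inj₁ refl) = place-first
    place-end (inj₂ refl) = place-last
  ... | ‵inject₁ j = ordinary-end end
    where
    ordinary-end : x ≡ even 0 ⊎ x ≡ even (N j) → InB (ordinary j x p)
    ordinary-end (inj₁ refl) = tt
    ordinary-end (inj₂ refl) = tt

  hub-adj : ∀ i j → toℕ j ≡ 0 ⊎ suc (toℕ j) ≡ 2 * k i ∸ 1 →
            Adj G (embed (inj₁ tt)) (embed (inj₂ (i , j)))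
  hub-adj i j e = KabPlus-adj-inB _ _ (petalVertex-inB i _ _ (end-position i j e))

  step-adj : ∀ i j j′ → suc (toℕ j) ≡ toℕ j′ → Adj G (embed (inj₂ (i , j))) (embed (inj₂ (i , j′)))
  step-adj i j j′ e = petalVertex-next i _ _ _ _ (cong halve e)

  embed-adj : ∀ u v → Adj (Flower (suc s) k) u v → Adj G (embed u) (embed v)
  embed-adj (inj₁ _) (inj₂ (i , j)) e = hub-adj i j e
  embed-adj (inj₂ (i , j)) (inj₁ _) e =
    G-sym (embed (inj₁ tt)) (embed (inj₂ (i , j))) (hub-adj i j e)
  embed-adj (inj₂ (i , j)) (inj₂ (.i , j′)) (refl , inj₁ e) = step-adj i j j′ e
  embed-adj (inj₂ (i , j)) (inj₂ (.i , j′)) (refl , inj₂ e) =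
    G-sym (embed (inj₂ (i , j′))) (embed (inj₂ (i , j))) (step-adj i j′ j e)

  flower⊆G : Flower (suc s) k ⊆G G
  flower⊆G = embed , embed-injective , embed-adj

flower⊆KabPlus : ∀ {E} → Symmetric E → ∀ s (k : Fin (suc s) → ℕ) → (∀ i → 1 ≤ k i) →
  CycleLayout E (k (fromℕ s) ∸ 1) →
  Flower (suc s) k ⊆G KabPlus E (kappa (suc s) k) (kappa (suc s) k + suc s + 1)
flower⊆KabPlus {E} E-sym s k k≥1 layout =
  subst₂ (λ a b → Flower (suc s) k ⊆G KabPlus E a b) a≡κ b≡κ+t+1 flower⊆G
  where
  open FlowerEmbedding E-sym s k k≥1 layout
  open ≡-Reasoning

  a≡κ : M + sum N ≡ kappa (suc s) k
  a≡κ = sym (begin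
    kappa (suc s) k ≡⟨ kappa≡sum (suc s) k ⟩
    sum m           ≡⟨ sum-init-last m ⟩
    sum N + M       ≡⟨ +-comm (sum N) M ⟩
    M + sum N       ∎)

  rearrange : ∀ a b c → 2 + a + (c + b) ≡ a + b + suc c + 1
  rearrange = solve-∀

  b≡κ+t+1 : suc (suc M) + sum N⁺ ≡ kappa (suc s) k + suc s + 1
  b≡κ+t+1 = begin
    suc (suc M) + sum N⁺        ≡⟨ cong (suc (suc M) +_) (sum-suc N) ⟩
    suc (suc M) + (s + sum N)   ≡⟨ rearrange M (sum N) s ⟩
    M + sum N + suc s + 1       ≡⟨ cong (λ κ → κ + suc s + 1) a≡κ ⟩
    kappa (suc s) k + suc s + 1 ∎

lemma4p6 : (s : ℕ) (k : Fin (suc s) → ℕ) →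
    (∀ i → 2 ≤ k i) →
    (∀ i j → i Data.Fin.≤ j → k i ≤ k j) →
    (k (fromℕ s) ≡ 2 → Flower (suc s) k ⊆G Kp (suc s) (2 * suc s + 1))
    × (3 ≤ k (fromℕ s) →
    (Flower (suc s) k ⊆G Kp (kappa (suc s) k) (kappa (suc s) k + suc s + 1))
    × (Flower (suc s) k ⊆G Km (kappa (suc s) k) (kappa (suc s) k + suc s + 1)))
lemma4p6 s k k≥2 mono = all-two , λ k≥3 →
    flower⊆Kp , flower⊆KabPlus M2Edge-sym s k k≥1 (m2Layout (∸-monoˡ-≤ 1 k≥3))
  where
  open ≡-Reasoning

  k≥1 : ∀ i → 1 ≤ k i
  k≥1 i = <⇒≤ (k≥2 i)

  flower⊆Kp : Flower (suc s) k ⊆G Kp (kappa (suc s) k) (kappa (suc s) k + suc s + 1)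
  flower⊆Kp = flower⊆KabPlus P3Edge-sym s k k≥1 (p3Layout (∸-monoˡ-≤ 1 (k≥2 (fromℕ s))))

  all-two : k (fromℕ s) ≡ 2 → Flower (suc s) k ⊆G Kp (suc s) (2 * suc s + 1)
  all-two kₜ≡2 = subst₂ (λ a b → Flower (suc s) k ⊆G Kp a b) κ≡t κ+t+1≡2t+1 flower⊆Kp
    where
    k≡2 : ∀ i → k i ≡ 2
    k≡2 i = ≤-antisym (subst (k i ≤_) kₜ≡2 (mono i (fromℕ s) (≤fromℕ i))) (k≥2 i)

    κ≡t : kappa (suc s) k ≡ suc s
    κ≡t = begin
      kappa (suc s) k       ≡⟨ kappa≡sum (suc s) k ⟩
      sum (λ i → k i ∸ 1)   ≡⟨ sum-cong-≗ (λ i → cong (_∸ 1) (k≡2 i)) ⟩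
      sum {suc s} (λ _ → 1) ≡⟨ sum-ones (suc s) ⟩
      suc s                 ∎

    κ+t+1≡2t+1 : kappa (suc s) k + suc s + 1 ≡ 2 * suc s + 1
    κ+t+1≡2t+1 = trans (cong (λ κ → κ + suc s + 1) κ≡t)
                       (cong (λ n → suc s + n + 1) (sym (+-identityʳ (suc s))))
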